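{- For every composition $\alpha$ and all $a,b\in\mathbb C$, $\omega\big(\widehat{\mathcal B}(a,b)_\alpha\big)=\widehat{\mathcal B}(-a,a+b)_{\alpha^r}$.
   Context: $[n-1]=\{1,\dots,n-1\}$; compositions of $n$ correspond to subsets of $[n-1]$ via $\mathrm{set}(\alpha_1,\dots,\alpha_l)=\{\alpha_1,\dots,\alpha_1+\dots+\alpha_{l-1}\}$ and inverse $\mathrm{comp}$; $\alpha^c=\mathrm{comp}([n-1]\setminus\mathrm{set}(\alpha))$; $\alpha^r=(\alpha_l,\dots,\alpha_1)$. $\mathsf{NSym}$ is the free associative $\mathbb C$-algebra on $H_1,H_2,\dots$, $H_\alpha=H_{\alpha_1}\cdots H_{\alpha_l}$; $\Lambda_\alpha=\sum_\beta(-1)^{n-\ell(\beta)}H_\beta$ over compositions $\beta$ of $n$ with $\mathrm{set}(\alpha)\subseteq\mathrm{set}(\beta)$. $\omega:\mathsf{NSym}\to\mathsf{NSym}$ is the involutive algebra anti-automorphism with $\omega(H_\alpha)=\Lambda_{\alpha^r}$. For $I\subseteq[n-1]$, $\mathcal B(a,b)_{\mathrm{comp}(I)}=\sum_{J\subseteq[n-1]:\,I\cup J=[n-1]}a^{|I\setminus J|}b^{|I\cap J|}H_{\mathrm{comp}(J)}$ (with $0^0=1$), and $\widehat{\mathcal B}(a,b)_\alpha=\mathcal B(a,b)_{\alpha^c}$. -}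

module Defs where

open import Level using (Level)
open import Algebra.Bundles using (CommutativeRing)
open import Data.Bool using (Bool; true; false; not; _∧_; _∨_; if_then_else_)
open import Data.Nat as ℕ using (ℕ; zero; suc; _∸_; _≤_)
import Data.Nat.Properties as ℕP
open import Data.List as L using (List; []; _∷_; _++_; reverse; length; map)
open import Data.Nat.ListAction using (sum)
import Data.List.Properties as LP
open import Data.List.Relation.Unary.All using (All)
open import Data.List.Membership.DecPropositional ℕP._≟_ using (_∈?_)
open import Data.Vec as V using (Vec; []; _∷_; tabulate; toList)
open import Data.Fin using (Fin; toℕ)
open import Data.Product using (_×_; _,_)
open import Relation.Nullary.Decidable using (does; yes; no)

Composition : Set
Composition = List ℕ

IsComposition : Composition → Set
IsComposition α = All (1 ≤_) α

size : Composition → ℕ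
size = sum

set : Composition → List ℕ
set []            = []
set (x ∷ [])      = []
set (x ∷ y ∷ rest) = x ∷ map (x ℕ.+_) (set (y ∷ rest))

-- Subsets of [n-1] = {1,…,n-1} are encoded as bit vectors of length n ∸ 1:
-- bit i (0-indexed) records whether i+1 belongs to the subset.
Subset : ℕ → Set
Subset n = Vec Bool (n ∸ 1)

toSubset : (n : ℕ) → List ℕ → Subset n
toSubset n S = tabulate (λ (i : Fin (n ∸ 1)) → does (suc (toℕ i) ∈? S))

private
  runs : ℕ → List Bool → Composition
  runs k []           = k ∷ []
  runs k (true ∷ bs)  = k ∷ runs 1 bs
  runs k (false ∷ bs) = runs (suc k) bs

comp : (n : ℕ) → Subset n → Composition
comp zero    _ = []
comp (suc m) v = runs 1 (toList v)

allVecs : (m : ℕ) → List (Vec Bool m)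
allVecs zero    = [] ∷ []
allVecs (suc m) = map (true ∷_) (allVecs m) ++ map (false ∷_) (allVecs m)

allSubsets : (n : ℕ) → List (Subset n)
allSubsets n = allVecs (n ∸ 1)

count : ∀ {m} → Vec Bool m → ℕ
count []          = 0
count (true ∷ v)  = suc (count v)
count (false ∷ v) = count v

complement : Composition → Composition
complement α = comp (size α) (V.map not (toSubset (size α) (set α)))

-- NSym is free on H₁,H₂,…, so the H_α (α a composition) form a basis; an
-- element is represented as a formal finite linear combination of H_α's
-- and two elements are equal iff all their H-coefficients agree.

module NSym {c ℓ : Level} (R : CommutativeRing c ℓ) where
  open CommutativeRing R public

  NSymElt : Set c
  NSymElt = List (Carrier × Composition)

  pow : Carrier → ℕ → Carrier
  pow x zero    = 1#
  pow x (suc k) = x * pow x k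

  zeroN : NSymElt
  zeroN = []

  H : Composition → NSymElt
  H α = (1# , α) ∷ []

  _⊕_ : NSymElt → NSymElt → NSymElt
  _⊕_ = _++_

  _⊙_ : Carrier → NSymElt → NSymElt
  r ⊙ f = map (λ { (s , α) → (r * s , α) }) f

  Σ[_]_ : ∀ {A : Set} → List A → (A → NSymElt) → NSymElt
  Σ[ xs ] f = L.concatMap f xs

  coeff : NSymElt → Composition → Carrier
  coeff []             β = 0#
  coeff ((r , α) ∷ f)  β with LP.≡-dec ℕP._≟_ α β
  ... | yes _ = r + coeff f β
  ... | no  _ = coeff f β

  infix 4 _≈ₙ_
  _≈ₙ_ : NSymElt → NSymElt → Set ℓ
  f ≈ₙ g = ∀ β → coeff f β ≈ coeff g β

  -- Λ_α = Σ_{β ⊨ n, set(α) ⊆ set(β)} (-1)^{n-ℓ(β)} H_β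
  Λ : Composition → NSymElt
  Λ α = Σ[ allSubsets n ] λ J →
          if contains J then pow (- 1#) (n ∸ length (comp n J)) ⊙ H (comp n J)
                        else zeroN
    where
      n = size α
      S = toSubset n (set α)
      contains : Subset n → Bool
      contains J = count (V.zipWith (λ s j → s ∧ not j) S J) ℕ.≡ᵇ 0

  ω : NSymElt → NSymElt
  ω []            = []
  ω ((r , α) ∷ f) = (r ⊙ Λ (reverse α)) ⊕ ω f

  -- B(a,b)_{comp(I)} = Σ_{J ⊆ [n-1], I ∪ J = [n-1]} a^{|I∖J|} b^{|I∩J|} H_{comp(J)}
  B : Carrier → Carrier → Composition → NSymElt
  B a b γ = Σ[ allSubsets n ] λ J →
              if count (V.map not (V.zipWith _∨_ I J)) ℕ.≡ᵇ 0
                then (pow a (count (V.zipWith (λ i j → i ∧ not j) I J))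
                       * pow b (count (V.zipWith _∧_ I J))) ⊙ H (comp n J)
                else zeroN
    where
      n = size γ
      I = toSubset n (set γ)

  Bhat : Carrier → Carrier → Composition → NSymElt
  Bhat a b α = B a b (complement α)

-- Index compositions of n = m + 1 by subsets of [m], encoded as bit vectors. In the basis H_{comp K},
-- B̂(a,b)_{comp S} = B(a,b)_{comp ¬S} and Λ_{comp X} have explicit entries, and ω sends H_{comp J} to
-- Λ_{comp (rev J)}; so the H_{comp K}-coefficient of ω(B̂(a,b)_{comp S}) is
-- Σ_J B(a,b)-entry(¬S, J) · Λ-entry(rev J, K). Reversing J and K simultaneously leaves the entries
-- unchanged, after which the summand is a product over coordinates, and the sum over the Boolean
-- cube factorises into per-coordinate sums. A four-case check shows these are exactly the
-- factors of the B(-a, a+b)-entry for ¬(rev S), i.e. the coefficient of B̂(-a,a+b)_{rev α}.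
module Submission where

open import Defs
open import Level using (Level)
open import Algebra.Bundles using (CommutativeRing; CommutativeMonoid)
import Algebra.Properties.CommutativeSemigroup as CommutativeSemigroupProperties
import Algebra.Properties.Ring as RingProperties
open import Data.Bool using (Bool; true; false; not; _∧_; _∨_; if_then_else_)
open import Data.Bool.Properties using (T-≡; ¬-not)
open import Data.Fin using (Fin; toℕ)
open import Data.List as L using (List; []; _∷_; _++_; map; reverse)
import Data.List.Properties as LP
import Data.Nat.Properties as ℕP
open import Data.List.Membership.DecPropositional ℕP._≟_ using (_∈?_)
open import Data.List.Relation.Unary.All using ([]; _∷_)
open import Data.Nat as ℕ using (ℕ; zero; suc)
open import Data.Product using (Σ; ∃₂; _×_; _,_; proj₁; proj₂)
open import Data.Vec as V using (Vec; []; _∷_; toList; tabulate)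
import Data.Vec.Properties as VP
open import Function using (_∘_)
open import Function.Bundles using (Equivalence)
open import Relation.Nullary.Decidable using (does; yes; no)
import Relation.Binary.PropositionalEquality as ≡
open ≡ using (_≡_)
import Relation.Binary.Reasoning.Setoid as SetoidReasoning

module Compositions where
  open import Data.Nat using (_+_; _∸_; _≤_; _<_; z≤n; s≤s)
  open ≡
  open ≡-Reasoning

  count-∷ʳ : ∀ {m} (xs : Vec Bool m) b → count (xs V.∷ʳ b) ≡ count (b ∷ xs)
  count-∷ʳ []           b     = refl
  count-∷ʳ (true ∷ xs)  true  = cong suc (count-∷ʳ xs true)
  count-∷ʳ (true ∷ xs)  false = cong suc (count-∷ʳ xs false)
  count-∷ʳ (false ∷ xs) true  = count-∷ʳ xs true
  count-∷ʳ (false ∷ xs) false = count-∷ʳ xs false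

  count-reverse : ∀ {m} (xs : Vec Bool m) → count (V.reverse xs) ≡ count xs
  count-reverse []       = refl
  count-reverse (x ∷ xs) = begin
    count (V.reverse (x ∷ xs))  ≡⟨ cong count (VP.reverse-∷ x xs) ⟩
    count (V.reverse xs V.∷ʳ x) ≡⟨ count-∷ʳ (V.reverse xs) x ⟩
    count (x ∷ V.reverse xs)    ≡⟨ cons x (count-reverse xs) ⟩
    count (x ∷ xs)              ∎
    where
    cons : ∀ b {k l} {ys : Vec Bool k} {zs : Vec Bool l} → count ys ≡ count zs → count (b ∷ ys) ≡ count (b ∷ zs)
    cons true  eq = cong suc eq
    cons false eq = eq

  count≤length : ∀ {m} (xs : Vec Bool m) → count xs ≤ m
  count≤length []           = z≤n
  count≤length (true ∷ xs)  = s≤s (count≤length xs)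
  count≤length (false ∷ xs) = ℕP.m≤n⇒m≤1+n (count≤length xs)

  count-map-not : ∀ {m} (xs : Vec Bool m) → count (V.map not xs) ≡ m ∸ count xs
  count-map-not []           = refl
  count-map-not (true ∷ xs)  = count-map-not xs
  count-map-not (false ∷ xs) =
    trans (cong suc (count-map-not xs)) (sym (ℕP.+-∸-assoc 1 (count≤length xs)))

  zipWith-∷ʳ : ∀ {A B C : Set} (f : A → B → C) {m} (xs : Vec A m) ys x y →
               V.zipWith f (xs V.∷ʳ x) (ys V.∷ʳ y) ≡ V.zipWith f xs ys V.∷ʳ f x y
  zipWith-∷ʳ f []       []       x y = refl
  zipWith-∷ʳ f (a ∷ xs) (b ∷ ys) x y = cong (f a b ∷_) (zipWith-∷ʳ f xs ys x y)

  zipWith-reverse : ∀ {A B C : Set} (f : A → B → C) {m} (xs : Vec A m) ys →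
                    V.zipWith f (V.reverse xs) (V.reverse ys) ≡ V.reverse (V.zipWith f xs ys)
  zipWith-reverse f []       []       = refl
  zipWith-reverse f (x ∷ xs) (y ∷ ys) = begin
    V.zipWith f (V.reverse (x ∷ xs)) (V.reverse (y ∷ ys))
      ≡⟨ cong₂ (V.zipWith f) (VP.reverse-∷ x xs) (VP.reverse-∷ y ys) ⟩
    V.zipWith f (V.reverse xs V.∷ʳ x) (V.reverse ys V.∷ʳ y)
      ≡⟨ zipWith-∷ʳ f (V.reverse xs) (V.reverse ys) x y ⟩
    V.zipWith f (V.reverse xs) (V.reverse ys) V.∷ʳ f x y
      ≡⟨ cong (V._∷ʳ f x y) (zipWith-reverse f xs ys) ⟩
    V.reverse (V.zipWith f xs ys) V.∷ʳ f x y
      ≡⟨ sym (VP.reverse-∷ (f x y) (V.zipWith f xs ys)) ⟩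
    V.reverse (V.zipWith f (x ∷ xs) (y ∷ ys)) ∎

  count-zipWith-reverse : ∀ (f : Bool → Bool → Bool) {m} (xs ys : Vec Bool m) →
                          count (V.zipWith f (V.reverse xs) (V.reverse ys)) ≡ count (V.zipWith f xs ys)
  count-zipWith-reverse f xs ys =
    trans (cong count (zipWith-reverse f xs ys)) (count-reverse (V.zipWith f xs ys))

  -- Defs keeps the run decoder behind comp private. Abstracting the literal 1 lets
  -- unification solve r as that decoder for every starting run length.
  runsDecoder : Σ (ℕ → (m : ℕ) → Vec Bool m → Composition)
                  λ r → ∀ m (v : Vec Bool m) → r 1 m v ≡ comp (suc m) v
  runsDecoder = r , fromOne
    where
    r : ℕ → (m : ℕ) → Vec Bool m → Composition
    r = _
    fromOne : ∀ m (v : Vec Bool m) → r 1 m v ≡ comp (suc m) v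
    fromOne with 1
    ... | _ = λ m v → refl

  runs : ℕ → (m : ℕ) → Vec Bool m → Composition
  runs = proj₁ runsDecoder

  size-runs : ∀ k m (v : Vec Bool m) → size (runs k m v) ≡ k + m
  size-runs k zero    []          = refl
  size-runs k (suc m) (true ∷ v)  = cong (k +_) (size-runs 1 m v)
  size-runs k (suc m) (false ∷ v) = trans (size-runs (suc k) m v) (sym (ℕP.+-suc k m))

  length-runs : ∀ k m (v : Vec Bool m) → L.length (runs k m v) ≡ suc (count v)
  length-runs k zero    []          = refl
  length-runs k (suc m) (true ∷ v)  = cong suc (length-runs 1 m v)
  length-runs k (suc m) (false ∷ v) = length-runs (suc k) m v

  size-comp : ∀ m (v : Vec Bool m) → size (comp (suc m) v) ≡ suc m
  size-comp = size-runs 1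

  length-comp : ∀ m (v : Vec Bool m) → L.length (comp (suc m) v) ≡ suc (count v)
  length-comp = length-runs 1

  _∈ᵇ_ : ℕ → List ℕ → Bool
  x ∈ᵇ xs = does (x ∈? xs)

  ≡⇒≡ᵇ≡true : ∀ {x y} → x ≡ y → (x ℕ.≡ᵇ y) ≡ true
  ≡⇒≡ᵇ≡true {x} {y} x≡y = Equivalence.to T-≡ (ℕP.≡⇒≡ᵇ x y x≡y)

  ≢⇒≡ᵇ≡false : ∀ {x y} → x ≢ y → (x ℕ.≡ᵇ y) ≡ false
  ≢⇒≡ᵇ≡false {x} {y} x≢y = ¬-not (λ eq → x≢y (ℕP.≡ᵇ⇒≡ x y (Equivalence.from T-≡ eq)))

  +-≡ᵇ-cancelˡ : ∀ c x y → ((c + x) ℕ.≡ᵇ (c + y)) ≡ (x ℕ.≡ᵇ y)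
  +-≡ᵇ-cancelˡ zero    x y = refl
  +-≡ᵇ-cancelˡ (suc c) x y = +-≡ᵇ-cancelˡ c x y

  +-∈ᵇ-map : ∀ c x xs → (c + x) ∈ᵇ map (c +_) xs ≡ x ∈ᵇ xs
  +-∈ᵇ-map c x []       = refl
  +-∈ᵇ-map c x (y ∷ xs) = cong₂ _∨_ (+-≡ᵇ-cancelˡ c x y) (+-∈ᵇ-map c x xs)

  <-∉ᵇ-map : ∀ {c x} xs → x < c → x ∈ᵇ map (c +_) xs ≡ false
  <-∉ᵇ-map             []       x<c = refl
  <-∉ᵇ-map {c}         (y ∷ xs) x<c =
    cong₂ _∨_ (≢⇒≡ᵇ≡false (ℕP.<⇒≢ (ℕP.<-≤-trans x<c (ℕP.m≤m+n c y)))) (<-∉ᵇ-map xs x<c)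

  set-∷-runs : ∀ x k m (v : Vec Bool m) → set (x ∷ runs k m v) ≡ x ∷ map (x +_) (set (runs k m v))
  set-∷-runs x k zero    []          = refl
  set-∷-runs x k (suc m) (true ∷ v)  = refl
  set-∷-runs x k (suc m) (false ∷ v) = set-∷-runs x (suc k) m v

  <-∉ᵇ-set-runs : ∀ {x} k m (v : Vec Bool m) → x < k → x ∈ᵇ set (runs k m v) ≡ false
  <-∉ᵇ-set-runs k zero    []          x<k = refl
  <-∉ᵇ-set-runs k (suc m) (true ∷ v)  x<k rewrite set-∷-runs k 1 m v =
    cong₂ _∨_ (≢⇒≡ᵇ≡false (ℕP.<⇒≢ x<k)) (<-∉ᵇ-map (set (runs 1 m v)) x<k)
  <-∉ᵇ-set-runs k (suc m) (false ∷ v) x<k = <-∉ᵇ-set-runs (suc k) m v (ℕP.m<n⇒m<1+n x<k)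

  bits-set-runs : ∀ p m (v : Vec Bool m) →
                  tabulate (λ (i : Fin m) → (suc p + toℕ i) ∈ᵇ set (runs (suc p) m v)) ≡ v
  bits-set-runs p zero    []          = refl
  bits-set-runs p (suc m) (true ∷ v) rewrite set-∷-runs (suc p) 1 m v =
    cong₂ _∷_ head (trans (VP.tabulate-cong tail) (bits-set-runs 0 m v))
    where
    head : (suc p + 0) ∈ᵇ (suc p ∷ map (suc p +_) (set (runs 1 m v))) ≡ true
    head = cong (_∨ ((suc p + 0) ∈ᵇ map (suc p +_) (set (runs 1 m v)))) (≡⇒≡ᵇ≡true (ℕP.+-identityʳ (suc p)))
    tail : ∀ (i : Fin m) → (suc p + suc (toℕ i)) ∈ᵇ (suc p ∷ map (suc p +_) (set (runs 1 m v)))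
                         ≡ suc (toℕ i) ∈ᵇ set (runs 1 m v)
    tail i = cong₂ _∨_ (≢⇒≡ᵇ≡false (ℕP.m+1+n≢m (suc p)))
                       (+-∈ᵇ-map (suc p) (suc (toℕ i)) (set (runs 1 m v)))
  bits-set-runs p (suc m) (false ∷ v) =
    cong₂ _∷_ (<-∉ᵇ-set-runs (suc (suc p)) m v (s≤s (s≤s (ℕP.≤-reflexive (ℕP.+-identityʳ p)))))
              (trans (VP.tabulate-cong shift) (bits-set-runs (suc p) m v))
    where
    shift : ∀ (i : Fin m) → (suc p + suc (toℕ i)) ∈ᵇ set (runs (suc (suc p)) m v)
                          ≡ (suc (suc p) + toℕ i) ∈ᵇ set (runs (suc (suc p)) m v)
    shift i = cong (_∈ᵇ set (runs (suc (suc p)) m v)) (ℕP.+-suc (suc p) (toℕ i))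

  toSubset-set-comp : ∀ m (v : Vec Bool m) → toSubset (suc m) (set (comp (suc m) v)) ≡ v
  toSubset-set-comp = bits-set-runs 0

  -- Run decoding with the first run lengthened by p and the last by q; reversal swaps p and q.
  paddedRuns : ℕ → ℕ → List Bool → Composition
  paddedRuns p q []           = suc (p + q) ∷ []
  paddedRuns p q (true ∷ bs)  = suc p ∷ paddedRuns 0 q bs
  paddedRuns p q (false ∷ bs) = paddedRuns (suc p) q bs

  runs≡paddedRuns : ∀ p m (v : Vec Bool m) → runs (suc p) m v ≡ paddedRuns p 0 (toList v)
  runs≡paddedRuns p zero    []          = cong (λ z → suc z ∷ []) (sym (ℕP.+-identityʳ p))
  runs≡paddedRuns p (suc m) (true ∷ v)  = cong (suc p ∷_) (runs≡paddedRuns 0 m v)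
  runs≡paddedRuns p (suc m) (false ∷ v) = runs≡paddedRuns (suc p) m v

  paddedRuns-∷ʳ-true : ∀ p q bs → paddedRuns p q (bs ++ true ∷ []) ≡ paddedRuns p 0 bs ++ suc q ∷ []
  paddedRuns-∷ʳ-true p q []           = cong (λ z → suc z ∷ suc q ∷ []) (sym (ℕP.+-identityʳ p))
  paddedRuns-∷ʳ-true p q (true ∷ bs)  = cong (suc p ∷_) (paddedRuns-∷ʳ-true 0 q bs)
  paddedRuns-∷ʳ-true p q (false ∷ bs) = paddedRuns-∷ʳ-true (suc p) q bs

  paddedRuns-∷ʳ-false : ∀ p q bs → paddedRuns p q (bs ++ false ∷ []) ≡ paddedRuns p (suc q) bs
  paddedRuns-∷ʳ-false p q []           = cong (λ z → suc z ∷ []) (sym (ℕP.+-suc p q))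
  paddedRuns-∷ʳ-false p q (true ∷ bs)  = cong (suc p ∷_) (paddedRuns-∷ʳ-false 0 q bs)
  paddedRuns-∷ʳ-false p q (false ∷ bs) = paddedRuns-∷ʳ-false (suc p) q bs

  reverse-paddedRuns : ∀ p q bs → L.reverse (paddedRuns p q bs) ≡ paddedRuns q p (L.reverse bs)
  reverse-paddedRuns p q []           = cong (λ z → suc z ∷ []) (ℕP.+-comm p q)
  reverse-paddedRuns p q (true ∷ bs)  = begin
    L.reverse (suc p ∷ paddedRuns 0 q bs)       ≡⟨ LP.unfold-reverse (suc p) (paddedRuns 0 q bs) ⟩
    L.reverse (paddedRuns 0 q bs) ++ suc p ∷ [] ≡⟨ cong (_++ suc p ∷ []) (reverse-paddedRuns 0 q bs) ⟩
    paddedRuns q 0 (L.reverse bs) ++ suc p ∷ [] ≡⟨ paddedRuns-∷ʳ-true q p (L.reverse bs) ⟨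
    paddedRuns q p (L.reverse bs ++ true ∷ [])  ≡⟨ cong (paddedRuns q p) (LP.unfold-reverse true bs) ⟨
    paddedRuns q p (L.reverse (true ∷ bs))      ∎
  reverse-paddedRuns p q (false ∷ bs) = begin
    L.reverse (paddedRuns (suc p) q bs)         ≡⟨ reverse-paddedRuns (suc p) q bs ⟩
    paddedRuns q (suc p) (L.reverse bs)         ≡⟨ paddedRuns-∷ʳ-false q p (L.reverse bs) ⟨
    paddedRuns q p (L.reverse bs ++ false ∷ []) ≡⟨ cong (paddedRuns q p) (LP.unfold-reverse false bs) ⟨
    paddedRuns q p (L.reverse (false ∷ bs))     ∎

  reverse-comp : ∀ m (v : Vec Bool m) → L.reverse (comp (suc m) v) ≡ comp (suc m) (V.reverse v)
  reverse-comp m v = begin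
    L.reverse (runs 1 m v)                    ≡⟨ cong L.reverse (runs≡paddedRuns 0 m v) ⟩
    L.reverse (paddedRuns 0 0 (toList v))     ≡⟨ reverse-paddedRuns 0 0 (toList v) ⟩
    paddedRuns 0 0 (L.reverse (toList v))     ≡⟨ cong (paddedRuns 0 0) (VP.toList-reverse v) ⟨
    paddedRuns 0 0 (toList (V.reverse v))     ≡⟨ runs≡paddedRuns 0 m (V.reverse v) ⟨
    runs 1 m (V.reverse v)                    ∎

  runs-replicate-false : ∀ k j m (v : Vec Bool m) → runs k (j + m) (V.replicate j false V.++ v) ≡ runs (j + k) m v
  runs-replicate-false k zero    m v = refl
  runs-replicate-false k (suc j) m v =
    trans (runs-replicate-false (suc k) j m v) (cong (λ z → runs z m v) (ℕP.+-suc j k))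

  comp-surjective : ∀ x xs → IsComposition (x ∷ xs) → ∃₂ λ m (v : Vec Bool m) → x ∷ xs ≡ comp (suc m) v
  comp-surjective (suc x) []       (s≤s z≤n ∷ []) =
    x + 0 , V.replicate x false V.++ [] ,
    trans (cong (_∷ []) (ℕP.+-comm 1 x)) (sym (runs-replicate-false 1 x 0 []))
  comp-surjective (suc x) (y ∷ ys) (s≤s z≤n ∷ ys⁺) with comp-surjective y ys ys⁺
  ... | m , v , eq =
    x + suc m , V.replicate x false V.++ (true ∷ v) ,
    trans (cong₂ _∷_ (ℕP.+-comm 1 x) eq) (sym (runs-replicate-false 1 x (suc m) (true ∷ v)))

  complement-comp : ∀ m (v : Vec Bool m) → complement (comp (suc m) v) ≡ comp (suc m) (V.map not v)
  complement-comp m v = at (size-comp m v) (toSubset-set-comp m v)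
    where
    at : ∀ {n} {X : Subset n} → size (comp (suc m) v) ≡ n → toSubset n (set (comp (suc m) v)) ≡ X →
         complement (comp (suc m) v) ≡ comp n (V.map not X)
    at refl refl = refl

  ∣_∖_∣ ∣_∩_∣ ∣_∪_∣ᶜ : ∀ {k} → Vec Bool k → Vec Bool k → ℕ
  ∣ I ∖ J ∣  = count (V.zipWith (λ i j → i ∧ not j) I J)
  ∣ I ∩ J ∣  = count (V.zipWith _∧_ I J)
  ∣ I ∪ J ∣ᶜ = count (V.map not (V.zipWith _∨_ I J))

  ∣_∣ᶜ : ∀ {k} → Vec Bool k → ℕ
  ∣ I ∣ᶜ = count (V.map not I)

  ∸-length-comp : ∀ m (v : Vec Bool m) → suc m ∸ L.length (comp (suc m) v) ≡ ∣ v ∣ᶜ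
  ∸-length-comp m v = trans (cong (suc m ∸_) (length-comp m v)) (sym (count-map-not v))

  ∣∖∣-reverse : ∀ {k} (I J : Vec Bool k) → ∣ V.reverse I ∖ V.reverse J ∣ ≡ ∣ I ∖ J ∣
  ∣∖∣-reverse = count-zipWith-reverse (λ i j → i ∧ not j)

  ∣∩∣-reverse : ∀ {k} (I J : Vec Bool k) → ∣ V.reverse I ∩ V.reverse J ∣ ≡ ∣ I ∩ J ∣
  ∣∩∣-reverse = count-zipWith-reverse _∧_

  ∣∣ᶜ-reverse : ∀ {k} (I : Vec Bool k) → ∣ V.reverse I ∣ᶜ ≡ ∣ I ∣ᶜ
  ∣∣ᶜ-reverse I = trans (cong count (VP.map-reverse not I)) (count-reverse (V.map not I))

  ∣∪∣ᶜ-reverse : ∀ {k} (I J : Vec Bool k) → ∣ V.reverse I ∪ V.reverse J ∣ᶜ ≡ ∣ I ∪ J ∣ᶜ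
  ∣∪∣ᶜ-reverse I J = trans (cong (λ U → ∣ U ∣ᶜ) (zipWith-reverse _∨_ I J)) (∣∣ᶜ-reverse (V.zipWith _∨_ I J))

open Compositions

module Coefficients {c ℓ : Level} (R : CommutativeRing c ℓ) where
  open NSym R
  open SetoidReasoning setoid
  open RingProperties ring using (-1*x≈-x)
  open CommutativeSemigroupProperties (CommutativeMonoid.commutativeSemigroup +-commutativeMonoid)
    using () renaming (interchange to +-interchange)
  open CommutativeSemigroupProperties (CommutativeMonoid.commutativeSemigroup *-commutativeMonoid)
    using () renaming (interchange to *-interchange; x∙yz≈y∙xz to x*yz≈y*xz)

  ≡⇒≈ : ∀ {x y} → x ≡ y → x ≈ y
  ≡⇒≈ ≡.refl = refl

  ∑ : ∀ {A : Set} → List A → (A → Carrier) → Carrier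
  ∑ []       g = 0#
  ∑ (x ∷ xs) g = g x + ∑ xs g

  ∑-cong : ∀ {A : Set} (xs : List A) {g h : A → Carrier} → (∀ x → g x ≈ h x) → ∑ xs g ≈ ∑ xs h
  ∑-cong []       g≈h = refl
  ∑-cong (x ∷ xs) g≈h = +-cong (g≈h x) (∑-cong xs g≈h)

  ∑-++ : ∀ {A : Set} (xs ys : List A) (g : A → Carrier) → ∑ (xs ++ ys) g ≈ ∑ xs g + ∑ ys g
  ∑-++ []       ys g = sym (+-identityˡ _)
  ∑-++ (x ∷ xs) ys g = trans (+-cong refl (∑-++ xs ys g)) (sym (+-assoc _ _ _))

  ∑-map : ∀ {A B : Set} (h : A → B) (xs : List A) (g : B → Carrier) → ∑ (map h xs) g ≡ ∑ xs (λ x → g (h x))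
  ∑-map h []       g = ≡.refl
  ∑-map h (x ∷ xs) g = ≡.cong (g (h x) +_) (∑-map h xs g)

  ∑-+ : ∀ {A : Set} (xs : List A) (g h : A → Carrier) → ∑ xs (λ x → g x + h x) ≈ ∑ xs g + ∑ xs h
  ∑-+ []       g h = sym (+-identityˡ _)
  ∑-+ (x ∷ xs) g h = trans (+-cong refl (∑-+ xs g h)) (+-interchange _ _ _ _)

  ∑-0 : ∀ {A : Set} (xs : List A) → ∑ xs (λ _ → 0#) ≈ 0#
  ∑-0 []       = refl
  ∑-0 (x ∷ xs) = trans (+-identityˡ _) (∑-0 xs)

  *-distribˡ-∑ : ∀ {A : Set} (xs : List A) k (g : A → Carrier) → k * ∑ xs g ≈ ∑ xs (λ x → k * g x)
  *-distribˡ-∑ []       k g = zeroʳ k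
  *-distribˡ-∑ (x ∷ xs) k g = trans (distribˡ k _ _) (+-cong refl (*-distribˡ-∑ xs k g))

  *-distribʳ-∑ : ∀ {A : Set} (xs : List A) k (g : A → Carrier) → ∑ xs g * k ≈ ∑ xs (λ x → g x * k)
  *-distribʳ-∑ []       k g = zeroˡ k
  *-distribʳ-∑ (x ∷ xs) k g = trans (distribʳ k _ _) (+-cong refl (*-distribʳ-∑ xs k g))

  ∑-comm : ∀ {A B : Set} (xs : List A) (ys : List B) (h : A → B → Carrier) →
           ∑ xs (λ x → ∑ ys (h x)) ≈ ∑ ys (λ y → ∑ xs (λ x → h x y))
  ∑-comm []       ys h = sym (∑-0 ys)
  ∑-comm (x ∷ xs) ys h = trans (+-cong refl (∑-comm xs ys h)) (sym (∑-+ ys (h x) _))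

  ∑-*-∑ : ∀ {A B : Set} (xs : List A) (ys : List B) (g : A → Carrier) (h : A → B → Carrier) (e : B → Carrier) →
          ∑ xs (λ x → g x * ∑ ys (λ y → h x y * e y)) ≈ ∑ ys (λ y → ∑ xs (λ x → g x * h x y) * e y)
  ∑-*-∑ xs ys g h e = begin
    ∑ xs (λ x → g x * ∑ ys (λ y → h x y * e y))
      ≈⟨ ∑-cong xs (λ x → trans (*-distribˡ-∑ ys (g x) _) (∑-cong ys (λ y → sym (*-assoc (g x) (h x y) (e y))))) ⟩
    ∑ xs (λ x → ∑ ys (λ y → (g x * h x y) * e y))
      ≈⟨ ∑-comm xs ys (λ x y → (g x * h x y) * e y) ⟩
    ∑ ys (λ y → ∑ xs (λ x → (g x * h x y) * e y))
      ≈⟨ ∑-cong ys (λ y → *-distribʳ-∑ xs (e y) (λ x → g x * h x y)) ⟨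
    ∑ ys (λ y → ∑ xs (λ x → g x * h x y) * e y) ∎

  coeff-++ : ∀ (f g : NSymElt) β → coeff (f ⊕ g) β ≈ coeff f β + coeff g β
  coeff-++ []            g β = sym (+-identityˡ _)
  coeff-++ ((r , α) ∷ f) g β with LP.≡-dec ℕP._≟_ α β
  ... | yes _ = trans (+-cong refl (coeff-++ f g β)) (sym (+-assoc _ _ _))
  ... | no  _ = coeff-++ f g β

  coeff-⊙ : ∀ r (f : NSymElt) β → coeff (r ⊙ f) β ≈ r * coeff f β
  coeff-⊙ r []            β = sym (zeroʳ r)
  coeff-⊙ r ((s , α) ∷ f) β with LP.≡-dec ℕP._≟_ α β
  ... | yes _ = trans (+-cong refl (coeff-⊙ r f β)) (sym (distribˡ r _ _))
  ... | no  _ = coeff-⊙ r f β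

  coeff-Σ : ∀ {A : Set} (xs : List A) (F : A → NSymElt) β → coeff (Σ[ xs ] F) β ≈ ∑ xs (λ x → coeff (F x) β)
  coeff-Σ []       F β = refl
  coeff-Σ (x ∷ xs) F β = trans (coeff-++ (F x) (Σ[ xs ] F) β) (+-cong refl (coeff-Σ xs F β))

  ω-++ : ∀ (f g : NSymElt) → ω (f ⊕ g) ≡ ω f ⊕ ω g
  ω-++ []            g = ≡.refl
  ω-++ ((r , α) ∷ f) g =
    ≡.trans (≡.cong ((r ⊙ Λ (L.reverse α)) ⊕_) (ω-++ f g)) (≡.sym (LP.++-assoc (r ⊙ Λ (L.reverse α)) (ω f) (ω g)))

  ω-Σ : ∀ {A : Set} (xs : List A) (F : A → NSymElt) → ω (Σ[ xs ] F) ≡ Σ[ xs ] (λ x → ω (F x))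
  ω-Σ []       F = ≡.refl
  ω-Σ (x ∷ xs) F = ≡.trans (ω-++ (F x) (Σ[ xs ] F)) (≡.cong (ω (F x) ⊕_) (ω-Σ xs F))

  guarded : Bool → Carrier → Carrier
  guarded p r = if p then r else 0#

  guarded-*ˡ : ∀ p k r → guarded p (k * r) ≈ k * guarded p r
  guarded-*ˡ true  k r = refl
  guarded-*ˡ false k r = sym (zeroʳ k)

  guarded-cong : ∀ p {r s} → r ≈ s → guarded p r ≈ guarded p s
  guarded-cong true  r≈s = r≈s
  guarded-cong false r≈s = refl

  coeff-term : ∀ p r γ β → coeff (if p then r ⊙ H γ else zeroN) β ≈ guarded p r * coeff (H γ) β
  coeff-term true  r γ β = coeff-⊙ r (H γ) β
  coeff-term false r γ β = sym (zeroˡ _)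

  coeff-ω-term : ∀ p r γ β → coeff (ω (if p then r ⊙ H γ else zeroN)) β ≈ guarded p r * coeff (Λ (L.reverse γ)) β
  coeff-ω-term true  r γ β = begin
    coeff (((r * 1#) ⊙ Λ (L.reverse γ)) ⊕ []) β ≈⟨ coeff-++ ((r * 1#) ⊙ Λ (L.reverse γ)) [] β ⟩
    coeff ((r * 1#) ⊙ Λ (L.reverse γ)) β + 0# ≈⟨ +-identityʳ _ ⟩
    coeff ((r * 1#) ⊙ Λ (L.reverse γ)) β      ≈⟨ coeff-⊙ (r * 1#) (Λ (L.reverse γ)) β ⟩
    (r * 1#) * coeff (Λ (L.reverse γ)) β      ≈⟨ *-cong (*-identityʳ r) refl ⟩
    r * coeff (Λ (L.reverse γ)) β             ∎
  coeff-ω-term false r γ β = sym (zeroˡ _)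

  -- Coefficients of H_{comp J} in B(a,b)_{comp I} and of H_{comp K} in Λ_{comp X}; the
  -- sign (-1)^{n - ℓ(comp K)} of Λ is written as (-1)^{|[n-1] ∖ K|}.
  B-entry : Carrier → Carrier → ∀ {k} → Vec Bool k → Vec Bool k → Carrier
  B-entry a b I J = guarded (∣ I ∪ J ∣ᶜ ℕ.≡ᵇ 0) (pow a ∣ I ∖ J ∣ * pow b ∣ I ∩ J ∣)

  Λ-entry : ∀ {k} → Vec Bool k → Vec Bool k → Carrier
  Λ-entry X K = guarded (∣ X ∖ K ∣ ℕ.≡ᵇ 0) (pow (- 1#) ∣ K ∣ᶜ)

  coeff-B : ∀ a b γ {n} {X : Subset n} → size γ ≡ n → toSubset n (set γ) ≡ X → ∀ β →
            coeff (B a b γ) β ≈ ∑ (allSubsets n) (λ K → B-entry a b X K * coeff (H (comp n K)) β)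
  coeff-B a b γ ≡.refl ≡.refl β = trans (coeff-Σ (allSubsets n) _ β) (∑-cong (allSubsets n) term)
    where
    n = size γ
    I = toSubset n (set γ)
    term : ∀ K → _
    term K = coeff-term (∣ I ∪ K ∣ᶜ ℕ.≡ᵇ 0) (pow a ∣ I ∖ K ∣ * pow b ∣ I ∩ K ∣) (comp n K) β

  coeff-ω-B : ∀ a b γ {n} {X : Subset n} → size γ ≡ n → toSubset n (set γ) ≡ X → ∀ β →
              coeff (ω (B a b γ)) β ≈ ∑ (allSubsets n) (λ J → B-entry a b X J * coeff (Λ (L.reverse (comp n J))) β)
  coeff-ω-B a b γ ≡.refl ≡.refl β =
    trans (≡⇒≈ (≡.cong (λ f → coeff f β) (ω-Σ (allSubsets n) _)))
          (trans (coeff-Σ (allSubsets n) _ β) (∑-cong (allSubsets n) term))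
    where
    n = size γ
    I = toSubset n (set γ)
    term : ∀ J → _
    term J = coeff-ω-term (∣ I ∪ J ∣ᶜ ℕ.≡ᵇ 0) (pow a ∣ I ∖ J ∣ * pow b ∣ I ∩ J ∣) (comp n J) β

  coeff-Λ : ∀ γ {n} {X : Subset n} → size γ ≡ n → toSubset n (set γ) ≡ X → ∀ β →
            coeff (Λ γ) β ≈ ∑ (allSubsets n) (λ K → guarded (∣ X ∖ K ∣ ℕ.≡ᵇ 0) (pow (- 1#) (n ℕ.∸ L.length (comp n K)))
                                                     * coeff (H (comp n K)) β)
  coeff-Λ γ ≡.refl ≡.refl β = trans (coeff-Σ (allSubsets n) _ β) (∑-cong (allSubsets n) term)
    where
    n = size γ
    term : ∀ K → _
    term K = coeff-term (∣ toSubset n (set γ) ∖ K ∣ ℕ.≡ᵇ 0) (pow (- 1#) (n ℕ.∸ L.length (comp n K))) (comp n K) β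

  coeff-Λ-comp : ∀ m (X : Vec Bool m) β →
                 coeff (Λ (comp (suc m) X)) β ≈ ∑ (allVecs m) (λ K → Λ-entry X K * coeff (H (comp (suc m) K)) β)
  coeff-Λ-comp m X β =
    trans (coeff-Λ (comp (suc m) X) (size-comp m X) (toSubset-set-comp m X) β) (∑-cong (allVecs m) sign)
    where
    sign : ∀ K → guarded (∣ X ∖ K ∣ ℕ.≡ᵇ 0) (pow (- 1#) (suc m ℕ.∸ L.length (comp (suc m) K)))
                 * coeff (H (comp (suc m) K)) β
                 ≈ Λ-entry X K * coeff (H (comp (suc m) K)) β
    sign K = *-cong (≡⇒≈ (≡.cong (λ e → guarded (∣ X ∖ K ∣ ℕ.≡ᵇ 0) (pow (- 1#) e)) (∸-length-comp m K))) refl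

  ∑-allVecs-multiplicative :
    ∀ {A : Set} (f : A → Bool → Carrier)
      (w : ∀ {k} → Vec A k → Vec Bool k → Carrier) (v : ∀ {k} → Vec A k → Carrier) →
    w [] [] ≈ v [] →
    (∀ x j {k} (P : Vec A k) J → w (x ∷ P) (j ∷ J) ≈ f x j * w P J) →
    (∀ x {k} (P : Vec A k) → v (x ∷ P) ≈ (f x true + f x false) * v P) →
    ∀ {k} (P : Vec A k) → ∑ (allVecs k) (w P) ≈ v P
  ∑-allVecs-multiplicative f w v w[]≈v[] w-∷ v-∷ []                = trans (+-identityʳ _) w[]≈v[]
  ∑-allVecs-multiplicative f w v w[]≈v[] w-∷ v-∷ {suc k} (x ∷ P) = begin
    ∑ (allVecs (suc k)) (w (x ∷ P))
      ≈⟨ ∑-++ (map (true ∷_) Js) (map (false ∷_) Js) (w (x ∷ P)) ⟩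
    ∑ (map (true ∷_) Js) (w (x ∷ P)) + ∑ (map (false ∷_) Js) (w (x ∷ P))
      ≡⟨ ≡.cong₂ _+_ (∑-map (true ∷_) Js (w (x ∷ P))) (∑-map (false ∷_) Js (w (x ∷ P))) ⟩
    ∑ Js (λ J → w (x ∷ P) (true ∷ J)) + ∑ Js (λ J → w (x ∷ P) (false ∷ J))
      ≈⟨ +-cong (∑-cong Js (w-∷ x true P)) (∑-cong Js (w-∷ x false P)) ⟩
    ∑ Js (λ J → f x true * w P J) + ∑ Js (λ J → f x false * w P J)
      ≈⟨ +-cong (*-distribˡ-∑ Js (f x true) (w P)) (*-distribˡ-∑ Js (f x false) (w P)) ⟨
    f x true * ∑ Js (w P) + f x false * ∑ Js (w P)
      ≈⟨ distribʳ (∑ Js (w P)) (f x true) (f x false) ⟨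
    (f x true + f x false) * ∑ Js (w P)
      ≈⟨ *-cong refl (∑-allVecs-multiplicative f w v w[]≈v[] w-∷ v-∷ P) ⟩
    (f x true + f x false) * v P
      ≈⟨ v-∷ x P ⟨
    v (x ∷ P) ∎
    where
    Js = allVecs k

  module Kernel (a b : Carrier) where
    -- Contribution of a coordinate with bits (s , t) of S and T and bit j of J to
    -- B-entry a b (¬S) J * Λ-entry J T; its sum over j is the coordinate's share of
    -- B-entry (- a) (a + b) (¬S) T.
    factor : Bool × Bool → Bool → Carrier
    factor (true  , true)  true  = 1#
    factor (true  , true)  false = 0#
    factor (true  , false) true  = 0#
    factor (true  , false) false = 0#
    factor (false , true)  true  = b
    factor (false , true)  false = a
    factor (false , false) true  = 0#
    factor (false , false) false = a * - 1#

    kernel : ∀ {k} → Vec (Bool × Bool) k → Vec Bool k → Carrier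
    kernel P J = B-entry a b (V.map (not ∘ proj₁) P) J * Λ-entry J (V.map proj₂ P)

    target : ∀ {k} → Vec (Bool × Bool) k → Carrier
    target P = B-entry (- a) (a + b) (V.map (not ∘ proj₁) P) (V.map proj₂ P)

    kernel-∷ : ∀ x j {k} (P : Vec (Bool × Bool) k) J → kernel (x ∷ P) (j ∷ J) ≈ factor x j * kernel P J
    kernel-∷ (true  , true)  true  P J = sym (*-identityˡ _)
    kernel-∷ (true  , true)  false P J = trans (zeroˡ _) (sym (zeroˡ _))
    kernel-∷ (true  , false) true  P J = trans (zeroʳ _) (sym (zeroˡ _))
    kernel-∷ (true  , false) false P J = trans (zeroˡ _) (sym (zeroˡ _))
    kernel-∷ (false , true)  true  P J =
      trans (*-cong (trans (guarded-cong _ (x*yz≈y*xz _ b _)) (guarded-*ˡ _ b _)) refl) (*-assoc b _ _)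
    kernel-∷ (false , true)  false P J =
      trans (*-cong (trans (guarded-cong _ (*-assoc a _ _)) (guarded-*ˡ _ a _)) refl) (*-assoc a _ _)
    kernel-∷ (false , false) true  P J = trans (zeroʳ _) (sym (zeroˡ _))
    kernel-∷ (false , false) false P J =
      trans (*-cong (trans (guarded-cong _ (*-assoc a _ _)) (guarded-*ˡ _ a _)) (guarded-*ˡ _ (- 1#) _))
            (*-interchange a _ (- 1#) _)

    target-∷ : ∀ x {k} (P : Vec (Bool × Bool) k) → target (x ∷ P) ≈ (factor x true + factor x false) * target P
    target-∷ (true  , true)  P = sym (trans (*-cong (+-identityʳ 1#) refl) (*-identityˡ _))
    target-∷ (true  , false) P = sym (trans (*-cong (+-identityʳ 0#) refl) (zeroˡ _))
    target-∷ (false , true)  P =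
      trans (trans (guarded-cong _ (x*yz≈y*xz _ (a + b) _)) (guarded-*ˡ _ (a + b) _)) (*-cong (+-comm a b) refl)
    target-∷ (false , false) P =
      trans (trans (guarded-cong _ (*-assoc (- a) _ _)) (guarded-*ˡ _ (- a) _))
            (*-cong (sym (trans (+-identityˡ _) (trans (*-comm a (- 1#)) (-1*x≈-x a)))) refl)

    ∑-kernel : ∀ {k} (P : Vec (Bool × Bool) k) → ∑ (allVecs k) (kernel P) ≈ target P
    ∑-kernel = ∑-allVecs-multiplicative factor kernel target (*-identityʳ _) kernel-∷ target-∷

  ∑-B-entry-Λ-entry : ∀ a b {k} (S T : Vec Bool k) →
            ∑ (allVecs k) (λ J → B-entry a b (V.map not S) J * Λ-entry J T) ≈ B-entry (- a) (a + b) (V.map not S) T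
  ∑-B-entry-Λ-entry a b S T =
    ≡.subst₂ (λ I T′ → ∑ (allVecs _) (λ J → B-entry a b I J * Λ-entry J T′) ≈ B-entry (- a) (a + b) I T′)
             (≡.trans (VP.map-∘ not proj₁ (V.zip S T)) (≡.cong (V.map not) (VP.map-proj₁-zip S T)))
             (VP.map-proj₂-zip S T)
             (Kernel.∑-kernel a b (V.zip S T))

  B-entry-reverse : ∀ a b {k} (I J : Vec Bool k) → B-entry a b (V.reverse I) (V.reverse J) ≡ B-entry a b I J
  B-entry-reverse a b I J =
    ≡.cong₂ (λ u r → guarded (u ℕ.≡ᵇ 0) r) (∣∪∣ᶜ-reverse I J)
            (≡.cong₂ (λ p q → pow a p * pow b q) (∣∖∣-reverse I J) (∣∩∣-reverse I J))

  Λ-entry-reverse : ∀ {k} (X K : Vec Bool k) → Λ-entry (V.reverse X) (V.reverse K) ≡ Λ-entry X K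
  Λ-entry-reverse X K =
    ≡.cong₂ (λ u p → guarded (u ℕ.≡ᵇ 0) (pow (- 1#) p)) (∣∖∣-reverse X K) (∣∣ᶜ-reverse K)

  ∑-B-entry-Λ-entry-reverse : ∀ a b {k} (S K : Vec Bool k) →
    ∑ (allVecs k) (λ J → B-entry a b (V.map not S) J * Λ-entry (V.reverse J) K) ≈ B-entry (- a) (a + b) (V.map not (V.reverse S)) K
  ∑-B-entry-Λ-entry-reverse a b {k} S K = begin
    ∑ (allVecs k) (λ J → B-entry a b (V.map not S) J * Λ-entry (V.reverse J) K)
      ≈⟨ ∑-cong (allVecs k) (λ J → *-cong refl (≡⇒≈ (reverse-left J))) ⟩
    ∑ (allVecs k) (λ J → B-entry a b (V.map not S) J * Λ-entry J (V.reverse K))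
      ≈⟨ ∑-B-entry-Λ-entry a b S (V.reverse K) ⟩
    B-entry (- a) (a + b) (V.map not S) (V.reverse K)
      ≡⟨ B-entry-reverse (- a) (a + b) (V.map not S) (V.reverse K) ⟨
    B-entry (- a) (a + b) (V.reverse (V.map not S)) (V.reverse (V.reverse K))
      ≡⟨ ≡.cong₂ (B-entry (- a) (a + b)) (≡.sym (VP.map-reverse not S)) (VP.reverse-involutive K) ⟩
    B-entry (- a) (a + b) (V.map not (V.reverse S)) K ∎
    where
    reverse-left : ∀ J → Λ-entry (V.reverse J) K ≡ Λ-entry J (V.reverse K)
    reverse-left J = ≡.trans (≡.cong (Λ-entry (V.reverse J)) (≡.sym (VP.reverse-involutive K))) (Λ-entry-reverse J (V.reverse K))

  ω-Bhat-comp : ∀ a b m (S : Vec Bool m) →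
                ω (Bhat a b (comp (suc m) S)) ≈ₙ Bhat (- a) (a + b) (L.reverse (comp (suc m) S))
  ω-Bhat-comp a b m S β = begin
    coeff (ω (Bhat a b (comp n S))) β
      ≡⟨ ≡.cong (λ γ → coeff (ω (B a b γ)) β) (complement-comp m S) ⟩
    coeff (ω (B a b (comp n (V.map not S)))) β
      ≈⟨ coeff-ω-B a b (comp n (V.map not S)) (size-comp m (V.map not S)) (toSubset-set-comp m (V.map not S)) β ⟩
    ∑ Js (λ J → B-entry a b (V.map not S) J * coeff (Λ (L.reverse (comp n J))) β)
      ≈⟨ ∑-cong Js (λ J → *-cong refl (coeff-Λ-reverse-comp J)) ⟩
    ∑ Js (λ J → B-entry a b (V.map not S) J * ∑ Js (λ K → Λ-entry (V.reverse J) K * e K))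
      ≈⟨ ∑-*-∑ Js Js (B-entry a b (V.map not S)) (λ J → Λ-entry (V.reverse J)) e ⟩
    ∑ Js (λ K → ∑ Js (λ J → B-entry a b (V.map not S) J * Λ-entry (V.reverse J) K) * e K)
      ≈⟨ ∑-cong Js (λ K → *-cong (∑-B-entry-Λ-entry-reverse a b S K) refl) ⟩
    ∑ Js (λ K → B-entry (- a) (a + b) (V.map not (V.reverse S)) K * e K)
      ≈⟨ coeff-B (- a) (a + b) (comp n (V.map not (V.reverse S)))
                 (size-comp m (V.map not (V.reverse S))) (toSubset-set-comp m (V.map not (V.reverse S))) β ⟨
    coeff (B (- a) (a + b) (comp n (V.map not (V.reverse S)))) β
      ≡⟨ ≡.cong (λ γ → coeff (B (- a) (a + b) γ) β) (complement-comp m (V.reverse S)) ⟨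
    coeff (Bhat (- a) (a + b) (comp n (V.reverse S))) β
      ≡⟨ ≡.cong (λ γ → coeff (Bhat (- a) (a + b) γ) β) (reverse-comp m S) ⟨
    coeff (Bhat (- a) (a + b) (L.reverse (comp n S))) β ∎
    where
    n = suc m
    Js = allVecs m
    e : Vec Bool m → Carrier
    e K = coeff (H (comp n K)) β
    coeff-Λ-reverse-comp : ∀ J → coeff (Λ (L.reverse (comp n J))) β ≈ ∑ Js (λ K → Λ-entry (V.reverse J) K * e K)
    coeff-Λ-reverse-comp J =
      trans (≡⇒≈ (≡.cong (λ γ → coeff (Λ γ) β) (reverse-comp m J))) (coeff-Λ-comp m (V.reverse J) β)

  coeff-singleton-cong : ∀ {r s} γ β → r ≈ s → coeff ((r , γ) ∷ []) β ≈ coeff ((s , γ) ∷ []) β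
  coeff-singleton-cong γ β r≈s with LP.≡-dec ℕP._≟_ γ β
  ... | yes _ = +-cong r≈s refl
  ... | no  _ = refl

  ω-Bhat-[] : ∀ a b → ω (Bhat a b []) ≈ₙ Bhat (- a) (a + b) []
  ω-Bhat-[] a b β = coeff-singleton-cong [] β (trans (*-cong refl (*-identityʳ 1#)) (*-identityʳ _))

proposition4p12 : ∀ {c ℓ : Level} (R : CommutativeRing c ℓ) →
    let open NSym R in
    (α : Composition) → IsComposition α → (a b : Carrier) →
      ω (Bhat a b α) ≈ₙ Bhat (- a) (a + b) (reverse α)
proposition4p12 R []       _      a b = Coefficients.ω-Bhat-[] R a b
proposition4p12 R (x ∷ xs) x∷xs⁺ a b with comp-surjective x xs x∷xs⁺
... | m , S , x∷xs≡S =
  ≡.subst (λ α → ω (Bhat a b α) ≈ₙ Bhat (- a) (a + b) (reverse α)) (≡.sym x∷xs≡S) (ω-Bhat-comp a b m S)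
  where
  open NSym R
  open Coefficients R
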